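{- Let $\mathsf{T}:\mathsf{Krip}\to\mathsf{Pos}$ be a functor, $\Lambda$ a set of predicate liftings for $\mathsf{T}$, $\mathrm{Ax}$ a set of sound rank-1 axioms of $\mathcal{L}(\Lambda)$, and $\mathsf{L}=\mathsf{L}^{(\Lambda,\mathrm{Ax})}$. Then the category of $(\mathsf{L},\mathsf{j})$-dialgebras is a variety of algebras.
   Context: $\mathsf{Krip}$: posets and p-morphisms; $\mathsf{Pos}$: posets and order-preserving maps; an $n$-ary predicate lifting is a natural family $\lambda_{(X,\le)}:\mathrm{Up}(X,\le)^n\to\mathrm{Up}(\mathsf{T}(X,\le))$ (upsets). $\mathcal{L}(\Lambda)$: intuitionistic propositional formulas over a countably infinite set of letters closed under $\heartsuit^\lambda(\phi_1,\dots,\phi_n)$, $\lambda\in\Lambda$ $n$-ary. A rank-1 formula is implication-free with every proposition letter in the scope of exactly one modal operator; a rank-1 axiom is $\phi\leftrightarrow\psi$ with $\phi,\psi$ rank-1; sound means valid on all $(\mathsf{i},\mathsf{T})$-dialgebras (posets $(X,\le)$ with order-preserving $\gamma:(X,\le)\to\mathsf{T}(X,\le)$, formulas interpreted intuitionistically with $x\Vdash\heartsuit^\lambda(\vec\phi)$ iff $\gamma(x)\in\lambda_{(X,\le)}([\![\vec\phi]\!])$). For a Heyting algebra $A$, $\mathsf{L}A$ is the distributive lattice freely generated by symbols $\dot\heartsuit^\lambda(a_1,\dots,a_n)$ ($a_i\in A$) modulo the equations obtained from $\mathrm{Ax}$ by replacing $\heartsuit$ by $\dot\heartsuit$, $\leftrightarrow$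 by $=$, and letters by elements of $A$; $\mathsf{L}h$ acts on generators by applying $h$ to arguments. $\mathsf{j}$ is the inclusion of Heyting algebras into distributive lattices. An $(\mathsf{L},\mathsf{j})$-dialgebra is a Heyting algebra $A$ with a lattice homomorphism $\alpha:\mathsf{L}A\to A$; morphisms are Heyting homomorphisms $h$ with $h\circ\alpha=\alpha'\circ\mathsf{L}h$. -}

module Defs where

open import Level using (Level; 0ℓ) renaming (suc to lsuc)
open import Data.Nat using (ℕ)
open import Data.Unit using (tt) renaming (⊤ to Unit)
open import Data.Empty using () renaming (⊥ to Empty)
open import Data.Sum using (_⊎_)
import Data.Sum
open import Data.Product using (Σ; Σ-syntax; ∃; _×_; _,_; proj₁; proj₂)
open import Data.Vec using (Vec; []; _∷_)
import Data.Vec as Vec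
open import Data.Vec.Relation.Unary.All using (All; []; _∷_)
open import Data.Vec.Relation.Binary.Pointwise.Inductive using (Pointwise)
open import Function using (_⇔_)
open import Relation.Binary using (Rel; Setoid; IsPartialOrder)
open import Relation.Binary.PropositionalEquality using (_≡_)
open import Relation.Binary.Lattice.Structures using (IsHeytingAlgebra)

record Pos : Set₁ where
  field
    Carrier        : Set
    _≤_            : Carrier → Carrier → Set
    isPartialOrder : IsPartialOrder _≡_ _≤_

open Pos public using (Carrier)

record Mono (X Y : Pos) : Set where
  private
    module X = Pos X
    module Y = Pos Y
  field
    fun  : X.Carrier → Y.Carrier
    mono : ∀ {x y} → x X.≤ y → fun x Y.≤ fun y

-- p-morphisms (morphisms of Krip): order preserving + back condition
record PMor (X Y : Pos) : Set where
  private
    module X = Pos X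
    module Y = Pos Y
  field
    fun  : X.Carrier → Y.Carrier
    mono : ∀ {x y} → x X.≤ y → fun x Y.≤ fun y
    back : ∀ {x y'} → fun x Y.≤ y' → Σ[ y ∈ X.Carrier ] (x X.≤ y × fun y ≡ y')

idP : (X : Pos) → PMor X X
idP X = record { fun = λ x → x ; mono = λ p → p
               ; back = λ {x} {y'} p → y' , p , Relation.Binary.PropositionalEquality.refl }

_∘P_ : {X Y Z : Pos} → PMor Y Z → PMor X Y → PMor X Z
_∘P_ {X} {Y} {Z} g f = record
  { fun  = λ x → G.fun (F.fun x)
  ; mono = λ p → G.mono (F.mono p)
  ; back = λ {x} {z'} p →
      let (y , y≤ , gy) = G.back p
          (x' , x≤ , fx) = F.back y≤
      in x' , x≤ , Relation.Binary.PropositionalEquality.trans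
                     (Relation.Binary.PropositionalEquality.cong G.fun fx) gy }
  where
    module F = PMor f
    module G = PMor g

-- A functor T : Krip → Pos (equality of morphisms is pointwise)
record Functor : Set₁ where
  field
    obj      : Pos → Pos
    fmap     : {X Y : Pos} → PMor X Y → Mono (obj X) (obj Y)
    fmap-ext : {X Y : Pos} (f g : PMor X Y) → (∀ x → PMor.fun f x ≡ PMor.fun g x) →
               ∀ t → Mono.fun (fmap f) t ≡ Mono.fun (fmap g) t
    fmap-id  : (X : Pos) → ∀ t → Mono.fun (fmap (idP X)) t ≡ t
    fmap-∘   : {X Y Z : Pos} (g : PMor Y Z) (f : PMor X Y) →
               ∀ t → Mono.fun (fmap (g ∘P f)) t ≡ Mono.fun (fmap g) (Mono.fun (fmap f) t)

record Up (X : Pos) : Set₁ where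
  field
    pred : Carrier X → Set
    up   : ∀ {x y} → Pos._≤_ X x y → pred x → pred y

open Up public

_≐_ : {X : Pos} → Up X → Up X → Set
_≐_ {X} U V = ∀ (x : Carrier X) → (pred U x ⇔ pred V x)

preimage : {X Y : Pos} → (f : Carrier X → Carrier Y) →
           (∀ {x y} → Pos._≤_ X x y → Pos._≤_ Y (f x) (f y)) → Up Y → Up X
preimage f m U = record { pred = λ x → pred U (f x) ; up = λ p u → up U (m p) u }

record PredLifting (T : Functor) (n : ℕ) : Set₁ where
  open Functor T
  field
    lift     : (X : Pos) → Vec (Up X) n → Up (obj X)
    lift-ext : (X : Pos) (us vs : Vec (Up X) n) → Pointwise _≐_ us vs →
               lift X us ≐ lift X vs
    natural  : {X Y : Pos} (f : PMor X Y) (us : Vec (Up Y) n) →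
               lift X (Vec.map (preimage (PMor.fun f) (PMor.mono f)) us)
                 ≐ preimage (Mono.fun (fmap f)) (Mono.mono (fmap f)) (lift Y us)

-- The language L(Λ): intuitionistic formulas over letters ℕ with modalities
-- indexed by I (modality i has arity ar i)

module Syntax (I : Set₁) (ar : I → ℕ) where

  data Form : Set₁ where
    var       : ℕ → Form
    ⊤F ⊥F     : Form
    _∧F_ _∨F_ _⇒F_ : Form → Form → Form
    ♡         : (i : I) → Vec Form (ar i) → Form

  data Rank0 : Form → Set₁ where
    var : ∀ n → Rank0 (var n)
    ⊤F  : Rank0 ⊤F
    ⊥F  : Rank0 ⊥F
    _∧F_ : ∀ {φ ψ} → Rank0 φ → Rank0 ψ → Rank0 (φ ∧F ψ)
    _∨F_ : ∀ {φ ψ} → Rank0 φ → Rank0 ψ → Rank0 (φ ∨F ψ)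

  data Rank1 : Form → Set₁ where
    ⊤F  : Rank1 ⊤F
    ⊥F  : Rank1 ⊥F
    _∧F_ : ∀ {φ ψ} → Rank1 φ → Rank1 ψ → Rank1 (φ ∧F ψ)
    _∨F_ : ∀ {φ ψ} → Rank1 φ → Rank1 ψ → Rank1 (φ ∨F ψ)
    ♡    : ∀ i {φs : Vec Form (ar i)} → All Rank0 φs → Rank1 (♡ i φs)

-- Dialgebraic semantics: (i,T)-dialgebras are posets X with γ : X → T X
-- order-preserving

module Semantics (T : Functor) (I : Set₁) (ar : I → ℕ)
                 (Λ : (i : I) → PredLifting T (ar i)) where
  open Syntax I ar
  open Functor T

  module _ (X : Pos) (γ : Mono X (obj X)) (V : ℕ → Up X) where
    private
      module X = Pos X
      open IsPartialOrder X.isPartialOrder using () renaming (trans to ≤-trans)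

    mutual
      ⟦_⟧ : Form → Up X
      ⟦ var n ⟧ = V n
      ⟦ ⊤F ⟧ = record { pred = λ _ → Unit ; up = λ _ _ → tt }
      ⟦ ⊥F ⟧ = record { pred = λ _ → Empty ; up = λ _ b → b }
      ⟦ φ ∧F ψ ⟧ = record { pred = λ x → pred ⟦ φ ⟧ x × pred ⟦ ψ ⟧ x
                          ; up = λ p (a , b) → up ⟦ φ ⟧ p a , up ⟦ ψ ⟧ p b }
      ⟦ φ ∨F ψ ⟧ = record { pred = λ x → pred ⟦ φ ⟧ x ⊎ pred ⟦ ψ ⟧ x
                          ; up = λ p → Data.Sum.map (up ⟦ φ ⟧ p) (up ⟦ ψ ⟧ p) }
      ⟦ φ ⇒F ψ ⟧ = record
        { pred = λ x → ∀ y → x X.≤ y → pred ⟦ φ ⟧ y → pred ⟦ ψ ⟧ y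
        ; up = λ p h z q → h z (≤-trans p q) }
      ⟦ ♡ i φs ⟧ = preimage (Mono.fun γ) (Mono.mono γ)
                     (PredLifting.lift (Λ i) X ⟦ φs ⟧*)

      ⟦_⟧* : ∀ {n} → Vec Form n → Vec (Up X) n
      ⟦ [] ⟧* = []
      ⟦ φ ∷ φs ⟧* = ⟦ φ ⟧ ∷ ⟦ φs ⟧*

  _,_,_,_⊩_ : (X : Pos) (γ : Mono X (obj X)) (V : ℕ → Up X) → Carrier X → Form → Set
  X , γ , V , x ⊩ φ = pred (⟦_⟧ X γ V φ) x

  Sound : Form × Form → Set₁
  Sound (φ , ψ) = (X : Pos) (γ : Mono X (obj X)) (V : ℕ → Up X) (x : Carrier X) →
                  (X , γ , V , x ⊩ φ) ⇔ (X , γ , V , x ⊩ ψ)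

record HAStr (S : Setoid 0ℓ 0ℓ) : Set₁ where
  open Setoid S using (_≈_) renaming (Carrier to A)
  field
    _≤_ : Rel A 0ℓ
    _∨_ _∧_ _⇨_ : A → A → A
    ⊤ ⊥ : A
    isHeytingAlgebra : IsHeytingAlgebra _≈_ _≤_ _∨_ _∧_ _⇨_ ⊤ ⊥

record IsHeytingHom {S S' : Setoid 0ℓ 0ℓ} (H : HAStr S) (H' : HAStr S')
                    (h : Setoid.Carrier S → Setoid.Carrier S') : Set where
  private
    module S  = Setoid S
    module S' = Setoid S'
    module H  = HAStr H
    module H' = HAStr H'
  field
    cong   : ∀ {a b} → a S.≈ b → h a S'.≈ h b
    pres-∧ : ∀ a b → h (a H.∧ b) S'.≈ (h a H'.∧ h b)
    pres-∨ : ∀ a b → h (a H.∨ b) S'.≈ (h a H'.∨ h b)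
    pres-⇨ : ∀ a b → h (a H.⇨ b) S'.≈ (h a H'.⇨ h b)
    pres-⊤ : h H.⊤ S'.≈ H'.⊤
    pres-⊥ : h H.⊥ S'.≈ H'.⊥

-- The functor L = L^(Λ,Ax) on Heyting algebras and (L,j)-dialgebras.
-- Λ is given by modality indices I with arities ar; Ax by a family of
-- rank-1 axiom pairs.

module LFunctor (I : Set₁) (ar : I → ℕ) (J : Set₁)
                (ax : J → Syntax.Form I ar × Syntax.Form I ar)
                (rk : (j : J) → Syntax.Rank1 I ar (proj₁ (ax j))
                              × Syntax.Rank1 I ar (proj₂ (ax j))) where
  open Syntax I ar

  -- terms of the free distributive lattice on the generators ♡̇^i(a⃗)
  data LTerm (A : Set) : Set₁ where
    gen  : (i : I) → Vec A (ar i) → LTerm A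
    top bot : LTerm A
    _∧L_ _∨L_ : LTerm A → LTerm A → LTerm A

  Lmap : {A B : Set} → (A → B) → LTerm A → LTerm B
  Lmap h (gen i as) = gen i (Vec.map h as)
  Lmap h top = top
  Lmap h bot = bot
  Lmap h (t ∧L u) = Lmap h t ∧L Lmap h u
  Lmap h (t ∨L u) = Lmap h t ∨L Lmap h u

  module _ {S : Setoid 0ℓ 0ℓ} (H : HAStr S) where
    open Setoid S using (_≈_) renaming (Carrier to A)
    open HAStr H

    ev0 : (σ : ℕ → A) (φ : Form) → Rank0 φ → A
    ev0 σ (var n) (var .n) = σ n
    ev0 σ ⊤F ⊤F = ⊤
    ev0 σ ⊥F ⊥F = ⊥
    ev0 σ (φ ∧F ψ) (p ∧F q) = ev0 σ φ p ∧ ev0 σ ψ q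
    ev0 σ (φ ∨F ψ) (p ∨F q) = ev0 σ φ p ∨ ev0 σ ψ q

    ev0* : (σ : ℕ → A) {n : ℕ} (φs : Vec Form n) → All Rank0 φs → Vec A n
    ev0* σ [] [] = []
    ev0* σ (φ ∷ φs) (p ∷ ps) = ev0 σ φ p ∷ ev0* σ φs ps

    tr : (σ : ℕ → A) (φ : Form) → Rank1 φ → LTerm A
    tr σ ⊤F ⊤F = top
    tr σ ⊥F ⊥F = bot
    tr σ (φ ∧F ψ) (p ∧F q) = tr σ φ p ∧L tr σ ψ q
    tr σ (φ ∨F ψ) (p ∨F q) = tr σ φ p ∨L tr σ ψ q
    tr σ (♡ i φs) (♡ .i ps) = gen i (ev0* σ φs ps)

    infix 4 _≋_
    data _≋_ : LTerm A → LTerm A → Set₁ where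
      ≋-refl  : ∀ {t} → t ≋ t
      ≋-sym   : ∀ {t u} → t ≋ u → u ≋ t
      ≋-trans : ∀ {t u v} → t ≋ u → u ≋ v → t ≋ v
      gen-cong : ∀ i {as bs : Vec A (ar i)} → Pointwise _≈_ as bs → gen i as ≋ gen i bs
      ∧-cong  : ∀ {t t' u u'} → t ≋ t' → u ≋ u' → (t ∧L u) ≋ (t' ∧L u')
      ∨-cong  : ∀ {t t' u u'} → t ≋ t' → u ≋ u' → (t ∨L u) ≋ (t' ∨L u')
      ∧-assoc : ∀ t u v → ((t ∧L u) ∧L v) ≋ (t ∧L (u ∧L v))
      ∨-assoc : ∀ t u v → ((t ∨L u) ∨L v) ≋ (t ∨L (u ∨L v))
      ∧-comm  : ∀ t u → (t ∧L u) ≋ (u ∧L t)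
      ∨-comm  : ∀ t u → (t ∨L u) ≋ (u ∨L t)
      ∧-absorbs-∨ : ∀ t u → (t ∧L (t ∨L u)) ≋ t
      ∨-absorbs-∧ : ∀ t u → (t ∨L (t ∧L u)) ≋ t
      ∧-distrib-∨ : ∀ t u v → (t ∧L (u ∨L v)) ≋ ((t ∧L u) ∨L (t ∧L v))
      ∧-top   : ∀ t → (t ∧L top) ≋ t
      ∨-bot   : ∀ t → (t ∨L bot) ≋ t
      axiom   : (j : J) (σ : ℕ → A) →
                tr σ (proj₁ (ax j)) (proj₁ (rk j)) ≋ tr σ (proj₂ (ax j)) (proj₂ (rk j))

  -- an (L,j)-dialgebra structure on a setoid: a Heyting algebra A together
  -- with a lattice homomorphism α : L A → A
  record Dialg (S : Setoid 0ℓ 0ℓ) : Set₁ where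
    open Setoid S using (_≈_) renaming (Carrier to A)
    field
      ha : HAStr S
    open HAStr ha
    field
      α     : LTerm A → A
      α-cong : ∀ {t u} → _≋_ ha t u → α t ≈ α u
      α-∧   : ∀ t u → α (t ∧L u) ≈ (α t ∧ α u)
      α-∨   : ∀ t u → α (t ∨L u) ≈ (α t ∨ α u)
      α-top : α top ≈ ⊤
      α-bot : α bot ≈ ⊥

  record IsDialgHom {S S' : Setoid 0ℓ 0ℓ} (D : Dialg S) (D' : Dialg S')
                    (h : Setoid.Carrier S → Setoid.Carrier S') : Set₁ where
    field
      heyting : IsHeytingHom (Dialg.ha D) (Dialg.ha D') h
      comm    : ∀ t → Setoid._≈_ S' (h (Dialg.α D t)) (Dialg.α D' (Lmap h t))

  record SameDialg {S : Setoid 0ℓ 0ℓ} (D D' : Dialg S) : Set₁ where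
    open Setoid S using (_≈_)
    private
      module H  = HAStr (Dialg.ha D)
      module H' = HAStr (Dialg.ha D')
    field
      same-≤ : ∀ a b → (a H.≤ b) ⇔ (a H'.≤ b)
      same-∧ : ∀ a b → (a H.∧ b) ≈ (a H'.∧ b)
      same-∨ : ∀ a b → (a H.∨ b) ≈ (a H'.∨ b)
      same-⇨ : ∀ a b → (a H.⇨ b) ≈ (a H'.⇨ b)
      same-⊤ : H.⊤ ≈ H'.⊤
      same-⊥ : H.⊥ ≈ H'.⊥
      same-α : ∀ t → Dialg.α D t ≈ Dialg.α D' t

record Signature : Set₂ where
  field
    Op    : Set₁
    arity : Op → ℕ

module UA (Σ' : Signature) where
  open Signature Σ'

  data Term : Set₁ where
    var : ℕ → Term
    op  : (o : Op) → Vec Term (arity o) → Term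

  record Equations : Set₂ where
    field
      Eq  : Set₁
      lhs rhs : Eq → Term

  record Algebra (S : Setoid 0ℓ 0ℓ) : Set₁ where
    open Setoid S using (_≈_) renaming (Carrier to A)
    field
      ⟦_⟧op   : (o : Op) → Vec A (arity o) → A
      op-cong : (o : Op) {as bs : Vec A (arity o)} → Pointwise _≈_ as bs →
                ⟦ o ⟧op as ≈ ⟦ o ⟧op bs

    mutual
      eval : (ℕ → A) → Term → A
      eval ρ (var n) = ρ n
      eval ρ (op o ts) = ⟦ o ⟧op (eval* ρ ts)

      eval* : (ℕ → A) → ∀ {n} → Vec Term n → Vec A n
      eval* ρ [] = []
      eval* ρ (t ∷ ts) = eval ρ t ∷ eval* ρ ts

  record Model (E : Equations) (S : Setoid 0ℓ 0ℓ) : Set₁ where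
    field
      algebra : Algebra S
    open Algebra algebra public
    field
      sat : (e : Equations.Eq E) (ρ : ℕ → Setoid.Carrier S) →
            Setoid._≈_ S (eval ρ (Equations.lhs E e)) (eval ρ (Equations.rhs E e))

  record IsAlgHom {S S' : Setoid 0ℓ 0ℓ} (M : Algebra S) (M' : Algebra S')
                  (h : Setoid.Carrier S → Setoid.Carrier S') : Set₁ where
    field
      cong : ∀ {a b} → Setoid._≈_ S a b → Setoid._≈_ S' (h a) (h b)
      pres : (o : Op) (as : Vec (Setoid.Carrier S) (arity o)) →
             Setoid._≈_ S' (h (Algebra.⟦_⟧op M o as)) (Algebra.⟦_⟧op M' o (Vec.map h as))

  record SameAlgebra {S : Setoid 0ℓ 0ℓ} (M M' : Algebra S) : Set₁ where
    field
      same-op : (o : Op) (as : Vec (Setoid.Carrier S) (arity o)) →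
                Setoid._≈_ S (Algebra.⟦_⟧op M o as) (Algebra.⟦_⟧op M' o as)

-- "The category of (L,j)-dialgebras is a variety of algebras": it is
-- concretely isomorphic (over setoids) to the category of models of some
-- finitary signature and set of equations.

module _ (I : Set₁) (ar : I → ℕ) (J : Set₁)
         (ax : J → Syntax.Form I ar × Syntax.Form I ar)
         (rk : (j : J) → Syntax.Rank1 I ar (proj₁ (ax j))
                       × Syntax.Rank1 I ar (proj₂ (ax j))) where
  open LFunctor I ar J ax rk

  record IsVarietyWitness (Sig : Signature) (E : UA.Equations Sig) : Set₂ where
    open UA Sig
    field
      F  : {S : Setoid 0ℓ 0ℓ} → Dialg S → Model E S
      G  : {S : Setoid 0ℓ 0ℓ} → Model E S → Dialg S
      GF : {S : Setoid 0ℓ 0ℓ} (D : Dialg S) → SameDialg (G (F D)) D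
      FG : {S : Setoid 0ℓ 0ℓ} (M : Model E S) →
           SameAlgebra (Model.algebra (F (G M))) (Model.algebra M)
      homF : {S S' : Setoid 0ℓ 0ℓ} (D : Dialg S) (D' : Dialg S')
             (h : Setoid.Carrier S → Setoid.Carrier S') →
             IsDialgHom D D' h ⇔ IsAlgHom (Model.algebra (F D)) (Model.algebra (F D')) h
      homG : {S S' : Setoid 0ℓ 0ℓ} (M : Model E S) (M' : Model E S')
             (h : Setoid.Carrier S → Setoid.Carrier S') →
             IsAlgHom (Model.algebra M) (Model.algebra M') h ⇔ IsDialgHom (G M) (G M') h

  DialgIsVariety : Set₂
  DialgIsVariety = Σ[ Sig ∈ Signature ] Σ[ E ∈ UA.Equations Sig ] IsVarietyWitness Sig E

-- L A is presented by the generators ♡̇ⁱ(a⃗) subject to lattice equations and the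
-- instances of Ax, so a lattice homomorphism α : L A → A amounts to an operation
-- ♡ⁱ : A^(ar i) → A for each modality (the image of the generators) such that every
-- axiom, read as an equation between rank-1 terms in these operations, holds in A.
-- Heyting algebras are themselves equationally definable (x ≤ y iff x ≈ x ∧ y), so
-- (L,j)-dialgebras are the models of the Heyting equations together with Ax; and a
-- Heyting homomorphism commutes with α iff it commutes with every ♡ⁱ.

module Submission where

open import Defs
open import Level using (_⊔_; 0ℓ)
open import Data.Nat using (ℕ)
open import Data.Product using (_×_; _,_; proj₁; proj₂)
open import Data.Vec using (Vec; []; _∷_)
import Data.Vec as Vec
open import Data.Vec.Relation.Unary.All using (All; []; _∷_)
open import Data.Vec.Relation.Binary.Pointwise.Inductive using (Pointwise; []; _∷_)
open import Function using (_⇔_; mk⇔; Equivalence)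
open import Function.Properties.Equivalence using () renaming (sym to Equivalence-sym; trans to Equivalence-trans)
open import Relation.Binary using (Rel; Setoid)
open import Relation.Binary.PropositionalEquality as ≡ using (_≡_)
open import Relation.Binary.Lattice using (HeytingAlgebra; MeetSemilattice)
open import Relation.Binary.Lattice.Structures using (IsMeetSemilattice; IsHeytingAlgebra)
open import Algebra.Core using (Op₂)
import Algebra.Definitions
import Algebra.Lattice.Bundles as AlgLattice
import Algebra.Lattice.Structures
import Algebra.Lattice.Properties.Lattice as AlgLatticeProperties
import Relation.Binary.Construct.NaturalOrder.Left as NaturalOrder
import Relation.Binary.Lattice.Properties.Lattice as LatticeProperties
import Relation.Binary.Lattice.Properties.BoundedLattice as BoundedLatticeProperties
import Relation.Binary.Lattice.Properties.BoundedMeetSemilattice as BoundedMeetProperties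
import Relation.Binary.Lattice.Properties.BoundedJoinSemilattice as BoundedJoinProperties
import Relation.Binary.Lattice.Properties.HeytingAlgebra as HeytingProperties
import Relation.Binary.Lattice.Properties.MeetSemilattice as MeetProperties
import Relation.Binary.Reasoning.PartialOrder as ≤-Reasoning
import Relation.Binary.Reasoning.Setoid as ≈-Reasoning

module HeytingEquations {a ℓ} {A : Set a} (_≈_ : Rel A ℓ)
                        (_∨_ _∧_ _⇨_ : Op₂ A) (⊤ ⊥ : A) where
  open Algebra.Definitions _≈_
  open Algebra.Lattice.Structures _≈_ using (IsLattice)
  open NaturalOrder _≈_ _∧_ using (_≤_)

  record IsAlgHeytingAlgebra : Set (a ⊔ ℓ) where
    field
      isLattice    : IsLattice _∨_ _∧_
      ⇨-cong       : Congruent₂ _⇨_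
      ∧-identityʳ  : RightIdentity ⊤ _∧_
      ∧-zeroˡ      : LeftZero ⊥ _∧_
      ⇨-app        : ∀ x y → ((x ⇨ y) ∧ x) ≈ (y ∧ x)
      ⇨-distribˡ-∧ : _⇨_ DistributesOverˡ _∧_
      x≤y⇨x∧y      : ∀ x y → x ≤ (y ⇨ (x ∧ y))

  ≤⇔≼ : ∀ {ℓ′} {_≼_ : Rel A ℓ′} → IsMeetSemilattice _≈_ _≼_ _∧_ →
        ∀ {x y} → (x ≤ y) ⇔ (x ≼ y)
  ≤⇔≼ isMeet {x} {y} = mk⇔ (λ x≤y → trans (reflexive x≤y) (x∧y≤y x y))
                           (λ x≼y → antisym (∧-greatest refl x≼y) (x∧y≤x x y))
    where open IsMeetSemilattice isMeet

  isAlgHeytingAlgebra : ∀ {ℓ′} {_≼_ : Rel A ℓ′} →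
                        IsHeytingAlgebra _≈_ _≼_ _∨_ _∧_ _⇨_ ⊤ ⊥ → IsAlgHeytingAlgebra
  isAlgHeytingAlgebra {ℓ′} isHA = record
    { isLattice    = LatticeProperties.isAlgLattice lattice
    ; ⇨-cong       = H.⇨-cong
    ; ∧-identityʳ  = BoundedMeetProperties.identityʳ boundedMeetSemilattice
    ; ∧-zeroˡ      = BoundedLatticeProperties.∧-zeroˡ boundedLattice
    ; ⇨-app        = λ _ _ → H.⇨-app
    ; ⇨-distribˡ-∧ = H.⇨-distribˡ-∧
    ; x≤y⇨x∧y      = λ _ _ → Equivalence.from (≤⇔≼ isMeetSemilattice) (transpose-⇨ refl)
    }
    where
      heytingAlgebra : HeytingAlgebra a ℓ ℓ′
      heytingAlgebra = record { isHeytingAlgebra = isHA }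
      open HeytingAlgebra heytingAlgebra
        using (lattice; boundedLattice; boundedMeetSemilattice; isMeetSemilattice; transpose-⇨; refl)
      module H = HeytingProperties heytingAlgebra

  isHeytingAlgebra : IsAlgHeytingAlgebra → IsHeytingAlgebra _≈_ _≤_ _∨_ _∧_ _⇨_ ⊤ ⊥
  isHeytingAlgebra H = record
    { isBoundedLattice = record
      { isLattice = AlgLatticeProperties.∨-∧-isOrderTheoreticLattice lattice
      ; maximum   = λ x → sym (∧-identityʳ x)
      ; minimum   = λ x → sym (∧-zeroˡ x)
      }
    ; exponential = λ w x y → curry w x y , uncurry w x y
    }
    where
      open IsAlgHeytingAlgebra H
      open IsLattice isLattice using (refl; sym; trans)

      lattice : AlgLattice.Lattice a ℓ
      lattice = record { isLattice = isLattice }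

      meetSemilattice : MeetSemilattice a ℓ ℓ
      meetSemilattice = AlgLatticeProperties.∧-orderTheoreticMeetSemilattice lattice
      open MeetSemilattice meetSemilattice using (poset; x∧y≤x) renaming (refl to ≤-refl)
      open MeetProperties meetSemilattice using (∧-monotonic)
      open ≤-Reasoning poset

      ⇨-monotonicʳ : ∀ {x y} z → x ≤ y → (z ⇨ x) ≤ (z ⇨ y)
      ⇨-monotonicʳ z x≤y = trans (⇨-cong refl x≤y) (⇨-distribˡ-∧ z _ _)

      curry : ∀ w x y → (w ∧ x) ≤ y → w ≤ (x ⇨ y)
      curry w x y w∧x≤y = begin
        w            ≤⟨ x≤y⇨x∧y w x ⟩
        x ⇨ (w ∧ x)  ≤⟨ ⇨-monotonicʳ x w∧x≤y ⟩
        x ⇨ y        ∎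

      uncurry : ∀ w x y → w ≤ (x ⇨ y) → (w ∧ x) ≤ y
      uncurry w x y w≤x⇨y = begin
        w ∧ x        ≤⟨ ∧-monotonic w≤x⇨y ≤-refl ⟩
        (x ⇨ y) ∧ x  ≈⟨ ⇨-app x y ⟩
        y ∧ x        ≤⟨ x∧y≤x y x ⟩
        y            ∎

open HeytingEquations using (IsAlgHeytingAlgebra; isAlgHeytingAlgebra; isHeytingAlgebra; ≤⇔≼)

module _ {Σ′ : Signature} where
  open UA Σ′

  SameAlgebra-sym : ∀ {S} {M M′ : Algebra S} → SameAlgebra M M′ → SameAlgebra M′ M
  SameAlgebra-sym {S} M≅M′ = record { same-op = λ o as → sym (SameAlgebra.same-op M≅M′ o as) }
    where open Setoid S using (sym)

  IsAlgHom-resp-SameAlgebra : ∀ {S S′} {M₁ M₂ : Algebra S} {M₁′ M₂′ : Algebra S′} →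
                              SameAlgebra M₁ M₂ → SameAlgebra M₁′ M₂′ →
                              ∀ {h} → IsAlgHom M₁ M₁′ h → IsAlgHom M₂ M₂′ h
  IsAlgHom-resp-SameAlgebra {S} {S′} {M₁} {M₂} {M₁′} {M₂′} M₁≅M₂ M₁′≅M₂′ {h} hom = record
    { cong = cong
    ; pres = λ o as → begin
        h (Algebra.⟦_⟧op M₂ o as)             ≈⟨ cong (Setoid.sym S (SameAlgebra.same-op M₁≅M₂ o as)) ⟩
        h (Algebra.⟦_⟧op M₁ o as)             ≈⟨ pres o as ⟩
        Algebra.⟦_⟧op M₁′ o (Vec.map h as)    ≈⟨ SameAlgebra.same-op M₁′≅M₂′ o (Vec.map h as) ⟩
        Algebra.⟦_⟧op M₂′ o (Vec.map h as)    ∎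
    }
    where
      open IsAlgHom hom
      open ≈-Reasoning S′

module Dialgebras (I : Set₁) (ar : I → ℕ) (J : Set₁)
                  (ax : J → Syntax.Form I ar × Syntax.Form I ar)
                  (rk : (j : J) → Syntax.Rank1 I ar (proj₁ (ax j))
                                × Syntax.Rank1 I ar (proj₂ (ax j))) where
  open Syntax I ar
  open LFunctor I ar J ax rk

  data Op : Set₁ where
    ∨ᵒ ∧ᵒ ⇨ᵒ ⊤ᵒ ⊥ᵒ : Op
    ♡ᵒ : I → Op

  arity : Op → ℕ
  arity ∨ᵒ = 2
  arity ∧ᵒ = 2
  arity ⇨ᵒ = 2
  arity ⊤ᵒ = 0
  arity ⊥ᵒ = 0
  arity (♡ᵒ i) = ar i

  signature : Signature
  signature = record { Op = Op ; arity = arity }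

  open UA signature

  infixr 5 _⇨ₜ_
  infixr 6 _∨ₜ_
  infixr 7 _∧ₜ_

  _∨ₜ_ _∧ₜ_ _⇨ₜ_ : Term → Term → Term
  s ∨ₜ t = op ∨ᵒ (s ∷ t ∷ [])
  s ∧ₜ t = op ∧ᵒ (s ∷ t ∷ [])
  s ⇨ₜ t = op ⇨ᵒ (s ∷ t ∷ [])

  ⊤ₜ ⊥ₜ : Term
  ⊤ₜ = op ⊤ᵒ []
  ⊥ₜ = op ⊥ᵒ []

  rank0Term : (φ : Form) → Rank0 φ → Term
  rank0Term (var n) (var .n) = var n
  rank0Term ⊤F ⊤F = ⊤ₜ
  rank0Term ⊥F ⊥F = ⊥ₜ
  rank0Term (φ ∧F ψ) (p ∧F q) = rank0Term φ p ∧ₜ rank0Term ψ q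
  rank0Term (φ ∨F ψ) (p ∨F q) = rank0Term φ p ∨ₜ rank0Term ψ q

  rank0Terms : ∀ {n} (φs : Vec Form n) → All Rank0 φs → Vec Term n
  rank0Terms [] [] = []
  rank0Terms (φ ∷ φs) (p ∷ ps) = rank0Term φ p ∷ rank0Terms φs ps

  rank1Term : (φ : Form) → Rank1 φ → Term
  rank1Term ⊤F ⊤F = ⊤ₜ
  rank1Term ⊥F ⊥F = ⊥ₜ
  rank1Term (φ ∧F ψ) (p ∧F q) = rank1Term φ p ∧ₜ rank1Term ψ q
  rank1Term (φ ∨F ψ) (p ∨F q) = rank1Term φ p ∨ₜ rank1Term ψ q
  rank1Term (♡ i φs) (♡ .i ps) = op (♡ᵒ i) (rank0Terms φs ps)

  data HeytingLaw : Set where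
    ∨-comm ∨-assoc ∧-comm ∧-assoc ∨-absorbs-∧ ∧-absorbs-∨ : HeytingLaw
    ∧-identityʳ ∧-zeroˡ ⇨-app ⇨-distribˡ-∧ x≤y⇨x∧y : HeytingLaw

  heytingLaw : HeytingLaw → (x y z : Term) → Term × Term
  heytingLaw ∨-comm       x y z = x ∨ₜ y , y ∨ₜ x
  heytingLaw ∨-assoc      x y z = (x ∨ₜ y) ∨ₜ z , x ∨ₜ (y ∨ₜ z)
  heytingLaw ∧-comm       x y z = x ∧ₜ y , y ∧ₜ x
  heytingLaw ∧-assoc      x y z = (x ∧ₜ y) ∧ₜ z , x ∧ₜ (y ∧ₜ z)
  heytingLaw ∨-absorbs-∧  x y z = x ∨ₜ (x ∧ₜ y) , x
  heytingLaw ∧-absorbs-∨  x y z = x ∧ₜ (x ∨ₜ y) , x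
  heytingLaw ∧-identityʳ  x y z = x ∧ₜ ⊤ₜ , x
  heytingLaw ∧-zeroˡ      x y z = ⊥ₜ ∧ₜ x , ⊥ₜ
  heytingLaw ⇨-app        x y z = (x ⇨ₜ y) ∧ₜ x , y ∧ₜ x
  heytingLaw ⇨-distribˡ-∧ x y z = x ⇨ₜ (y ∧ₜ z) , (x ⇨ₜ y) ∧ₜ (x ⇨ₜ z)
  heytingLaw x≤y⇨x∧y      x y z = x , x ∧ₜ (y ⇨ₜ (x ∧ₜ y))

  data Eqn : Set₁ where
    law   : HeytingLaw → Eqn
    axiom : J → Eqn

  equation : Eqn → Term × Term
  equation (law l)   = heytingLaw l (var 0) (var 1) (var 2)
  equation (axiom j) = rank1Term (proj₁ (ax j)) (proj₁ (rk j)) , rank1Term (proj₂ (ax j)) (proj₂ (rk j))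

  equations : Equations
  equations = record { Eq = Eqn ; lhs = λ e → proj₁ (equation e) ; rhs = λ e → proj₂ (equation e) }

  module _ {S : Setoid 0ℓ 0ℓ} (M : Algebra S) where
    open Setoid S renaming (Carrier to A)
    open Algebra M

    evalL : LTerm A → A
    evalL (gen i as) = ⟦ ♡ᵒ i ⟧op as
    evalL top        = ⟦ ⊤ᵒ ⟧op []
    evalL bot        = ⟦ ⊥ᵒ ⟧op []
    evalL (t ∧L u)   = ⟦ ∧ᵒ ⟧op (evalL t ∷ evalL u ∷ [])
    evalL (t ∨L u)   = ⟦ ∨ᵒ ⟧op (evalL t ∷ evalL u ∷ [])

    module _ (H : HAStr S)
             (∨-agrees : ∀ a b → HAStr._∨_ H a b ≡ ⟦ ∨ᵒ ⟧op (a ∷ b ∷ []))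
             (∧-agrees : ∀ a b → HAStr._∧_ H a b ≡ ⟦ ∧ᵒ ⟧op (a ∷ b ∷ []))
             (⊤-agrees : HAStr.⊤ H ≡ ⟦ ⊤ᵒ ⟧op [])
             (⊥-agrees : HAStr.⊥ H ≡ ⟦ ⊥ᵒ ⟧op []) where

      eval-rank0Term : ∀ ρ φ (p : Rank0 φ) → eval ρ (rank0Term φ p) ≡ ev0 H ρ φ p
      eval-rank0Term ρ (var n) (var .n) = ≡.refl
      eval-rank0Term ρ ⊤F ⊤F = ≡.sym ⊤-agrees
      eval-rank0Term ρ ⊥F ⊥F = ≡.sym ⊥-agrees
      eval-rank0Term ρ (φ ∧F ψ) (p ∧F q) =
        ≡.trans (≡.cong₂ (λ a b → ⟦ ∧ᵒ ⟧op (a ∷ b ∷ [])) (eval-rank0Term ρ φ p) (eval-rank0Term ρ ψ q))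
                (≡.sym (∧-agrees _ _))
      eval-rank0Term ρ (φ ∨F ψ) (p ∨F q) =
        ≡.trans (≡.cong₂ (λ a b → ⟦ ∨ᵒ ⟧op (a ∷ b ∷ [])) (eval-rank0Term ρ φ p) (eval-rank0Term ρ ψ q))
                (≡.sym (∨-agrees _ _))

      eval*-rank0Terms : ∀ ρ {n} (φs : Vec Form n) (ps : All Rank0 φs) →
                         eval* ρ (rank0Terms φs ps) ≡ ev0* H ρ φs ps
      eval*-rank0Terms ρ [] [] = ≡.refl
      eval*-rank0Terms ρ (φ ∷ φs) (p ∷ ps) =
        ≡.cong₂ _∷_ (eval-rank0Term ρ φ p) (eval*-rank0Terms ρ φs ps)

      eval-rank1Term : ∀ ρ φ (p : Rank1 φ) → eval ρ (rank1Term φ p) ≡ evalL (tr H ρ φ p)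
      eval-rank1Term ρ ⊤F ⊤F = ≡.refl
      eval-rank1Term ρ ⊥F ⊥F = ≡.refl
      eval-rank1Term ρ (φ ∧F ψ) (p ∧F q) =
        ≡.cong₂ (λ a b → ⟦ ∧ᵒ ⟧op (a ∷ b ∷ [])) (eval-rank1Term ρ φ p) (eval-rank1Term ρ ψ q)
      eval-rank1Term ρ (φ ∨F ψ) (p ∨F q) =
        ≡.cong₂ (λ a b → ⟦ ∨ᵒ ⟧op (a ∷ b ∷ [])) (eval-rank1Term ρ φ p) (eval-rank1Term ρ ψ q)
      eval-rank1Term ρ (♡ i φs) (♡ .i ps) = ≡.cong ⟦ ♡ᵒ i ⟧op (eval*-rank0Terms ρ φs ps)

  evalL-hom : ∀ {S S′} {M : Algebra S} {M′ : Algebra S′} {h} → IsAlgHom M M′ h →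
              ∀ t → Setoid._≈_ S′ (h (evalL M t)) (evalL M′ (Lmap h t))
  evalL-hom hom (gen i as) = IsAlgHom.pres hom (♡ᵒ i) as
  evalL-hom hom top        = IsAlgHom.pres hom ⊤ᵒ []
  evalL-hom hom bot        = IsAlgHom.pres hom ⊥ᵒ []
  evalL-hom {S′ = S′} {M′ = M′} hom (t ∧L u) =
    Setoid.trans S′ (IsAlgHom.pres hom ∧ᵒ _) (Algebra.op-cong M′ ∧ᵒ (evalL-hom hom t ∷ evalL-hom hom u ∷ []))
  evalL-hom {S′ = S′} {M′ = M′} hom (t ∨L u) =
    Setoid.trans S′ (IsAlgHom.pres hom ∨ᵒ _) (Algebra.op-cong M′ ∨ᵒ (evalL-hom hom t ∷ evalL-hom hom u ∷ []))

  module FromDialg {S : Setoid 0ℓ 0ℓ} (D : Dialg S) where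
    open Setoid S renaming (Carrier to A)
    open Dialg D
    open HAStr ha using (_∨_; _∧_; _⇨_; ⊤; ⊥)

    private
      module H = IsAlgHeytingAlgebra (isAlgHeytingAlgebra _≈_ _∨_ _∧_ _⇨_ ⊤ ⊥ (HAStr.isHeytingAlgebra ha))
      module L = Algebra.Lattice.Structures.IsLattice H.isLattice

    ops : (o : Op) → Vec A (arity o) → A
    ops ∨ᵒ (a ∷ b ∷ []) = a ∨ b
    ops ∧ᵒ (a ∷ b ∷ []) = a ∧ b
    ops ⇨ᵒ (a ∷ b ∷ []) = a ⇨ b
    ops ⊤ᵒ []           = ⊤
    ops ⊥ᵒ []           = ⊥
    ops (♡ᵒ i) as       = α (gen i as)

    ops-cong : (o : Op) {as bs : Vec A (arity o)} → Pointwise _≈_ as bs → ops o as ≈ ops o bs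
    ops-cong ∨ᵒ (p ∷ q ∷ []) = L.∨-cong p q
    ops-cong ∧ᵒ (p ∷ q ∷ []) = L.∧-cong p q
    ops-cong ⇨ᵒ (p ∷ q ∷ []) = H.⇨-cong p q
    ops-cong ⊤ᵒ []           = refl
    ops-cong ⊥ᵒ []           = refl
    ops-cong (♡ᵒ i) ps       = α-cong (gen-cong i ps)

    algebra : Algebra S
    algebra = record { ⟦_⟧op = ops ; op-cong = ops-cong }

    α≈evalL : ∀ t → α t ≈ evalL algebra t
    α≈evalL (gen i as) = refl
    α≈evalL top        = α-top
    α≈evalL bot        = α-bot
    α≈evalL (t ∧L u)   = trans (α-∧ t u) (L.∧-cong (α≈evalL t) (α≈evalL u))
    α≈evalL (t ∨L u)   = trans (α-∨ t u) (L.∨-cong (α≈evalL t) (α≈evalL u))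

    eval-rank1Term≈α : ∀ ρ φ (p : Rank1 φ) → Algebra.eval algebra ρ (rank1Term φ p) ≈ α (tr ha ρ φ p)
    eval-rank1Term≈α ρ φ p =
      trans (reflexive (eval-rank1Term algebra ha (λ _ _ → ≡.refl) (λ _ _ → ≡.refl) ≡.refl ≡.refl ρ φ p))
            (sym (α≈evalL (tr ha ρ φ p)))

    sat : (e : Eqn) (ρ : ℕ → A) →
          Algebra.eval algebra ρ (proj₁ (equation e)) ≈ Algebra.eval algebra ρ (proj₂ (equation e))
    sat (law ∨-comm)       ρ = L.∨-comm _ _
    sat (law ∨-assoc)      ρ = L.∨-assoc _ _ _
    sat (law ∧-comm)       ρ = L.∧-comm _ _
    sat (law ∧-assoc)      ρ = L.∧-assoc _ _ _
    sat (law ∨-absorbs-∧)  ρ = L.∨-absorbs-∧ _ _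
    sat (law ∧-absorbs-∨)  ρ = L.∧-absorbs-∨ _ _
    sat (law ∧-identityʳ)  ρ = H.∧-identityʳ _
    sat (law ∧-zeroˡ)      ρ = H.∧-zeroˡ _
    sat (law ⇨-app)        ρ = H.⇨-app _ _
    sat (law ⇨-distribˡ-∧) ρ = H.⇨-distribˡ-∧ _ _ _
    sat (law x≤y⇨x∧y)      ρ = H.x≤y⇨x∧y _ _
    sat (axiom j)          ρ =
      trans (eval-rank1Term≈α ρ _ (proj₁ (rk j)))
            (trans (α-cong (axiom j ρ)) (sym (eval-rank1Term≈α ρ _ (proj₂ (rk j)))))

    model : Model equations S
    model = record { algebra = algebra ; sat = sat }

  module ToDialg {S : Setoid 0ℓ 0ℓ} (M : Model equations S) where
    open Setoid S renaming (Carrier to A)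
    open Model M using (algebra; ⟦_⟧op; op-cong; eval)

    _∨_ _∧_ _⇨_ : A → A → A
    a ∨ b = ⟦ ∨ᵒ ⟧op (a ∷ b ∷ [])
    a ∧ b = ⟦ ∧ᵒ ⟧op (a ∷ b ∷ [])
    a ⇨ b = ⟦ ⇨ᵒ ⟧op (a ∷ b ∷ [])

    ⊤ ⊥ : A
    ⊤ = ⟦ ⊤ᵒ ⟧op []
    ⊥ = ⟦ ⊥ᵒ ⟧op []

    env : A → A → A → ℕ → A
    env a b c 0 = a
    env a b c 1 = b
    env a b c _ = c

    holds : ∀ l a b c → eval (env a b c) (proj₁ (heytingLaw l (var 0) (var 1) (var 2)))
                    ≈ eval (env a b c) (proj₂ (heytingLaw l (var 0) (var 1) (var 2)))
    holds l a b c = Model.sat M (law l) (env a b c)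

    isAlgHA : IsAlgHeytingAlgebra _≈_ _∨_ _∧_ _⇨_ ⊤ ⊥
    isAlgHA = record
      { isLattice = record
        { isEquivalence = isEquivalence
        ; ∨-comm        = λ a b → holds ∨-comm a b a
        ; ∨-assoc       = holds ∨-assoc
        ; ∨-cong        = λ p q → op-cong ∨ᵒ (p ∷ q ∷ [])
        ; ∧-comm        = λ a b → holds ∧-comm a b a
        ; ∧-assoc       = holds ∧-assoc
        ; ∧-cong        = λ p q → op-cong ∧ᵒ (p ∷ q ∷ [])
        ; absorptive    = (λ a b → holds ∨-absorbs-∧ a b a) , (λ a b → holds ∧-absorbs-∨ a b a)
        }
      ; ⇨-cong       = λ p q → op-cong ⇨ᵒ (p ∷ q ∷ [])
      ; ∧-identityʳ  = λ a → holds ∧-identityʳ a a a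
      ; ∧-zeroˡ      = λ a → holds ∧-zeroˡ a a a
      ; ⇨-app        = λ a b → holds ⇨-app a b a
      ; ⇨-distribˡ-∧ = holds ⇨-distribˡ-∧
      ; x≤y⇨x∧y      = λ a b → holds x≤y⇨x∧y a b a
      }

    heytingAlgebra : HeytingAlgebra 0ℓ 0ℓ 0ℓ
    heytingAlgebra = record { isHeytingAlgebra = isHeytingAlgebra _≈_ _∨_ _∧_ _⇨_ ⊤ ⊥ isAlgHA }

    ha : HAStr S
    ha = record { isHeytingAlgebra = HeytingAlgebra.isHeytingAlgebra heytingAlgebra }

    private
      module H = IsAlgHeytingAlgebra isAlgHA
      module L = Algebra.Lattice.Structures.IsLattice H.isLattice

    α-cong : ∀ {t u} → _≋_ ha t u → evalL algebra t ≈ evalL algebra u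
    α-cong ≋-refl                = refl
    α-cong (≋-sym p)             = sym (α-cong p)
    α-cong (≋-trans p q)         = trans (α-cong p) (α-cong q)
    α-cong (gen-cong i ps)       = op-cong (♡ᵒ i) ps
    α-cong (∧-cong p q)          = L.∧-cong (α-cong p) (α-cong q)
    α-cong (∨-cong p q)          = L.∨-cong (α-cong p) (α-cong q)
    α-cong (∧-assoc t u v)       = L.∧-assoc _ _ _
    α-cong (∨-assoc t u v)       = L.∨-assoc _ _ _
    α-cong (∧-comm t u)          = L.∧-comm _ _
    α-cong (∨-comm t u)          = L.∨-comm _ _
    α-cong (∧-absorbs-∨ t u)     = L.∧-absorbs-∨ _ _
    α-cong (∨-absorbs-∧ t u)     = L.∨-absorbs-∧ _ _
    α-cong (∧-distrib-∨ t u v)   = HeytingProperties.∧-distribˡ-∨ heytingAlgebra _ _ _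
    α-cong (∧-top t)             = H.∧-identityʳ _
    α-cong (∨-bot t)             = BoundedJoinProperties.identityʳ
                                     (HeytingAlgebra.boundedJoinSemilattice heytingAlgebra) _
    α-cong (axiom j σ)           =
      trans (reflexive (≡.sym (eval≡evalL (proj₁ (rk j)))))
            (trans (Model.sat M (axiom j) σ) (reflexive (eval≡evalL (proj₂ (rk j)))))
      where
        eval≡evalL : ∀ {φ} (p : Rank1 φ) → eval σ (rank1Term φ p) ≡ evalL algebra (tr ha σ φ p)
        eval≡evalL = eval-rank1Term algebra ha (λ _ _ → ≡.refl) (λ _ _ → ≡.refl) ≡.refl ≡.refl σ _

    dialg : Dialg S
    dialg = record
      { ha = ha ; α = evalL algebra ; α-cong = α-cong
      ; α-∧ = λ _ _ → refl ; α-∨ = λ _ _ → refl ; α-top = refl ; α-bot = refl }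

  toModel : ∀ {S} → Dialg S → Model equations S
  toModel = FromDialg.model

  toDialg : ∀ {S} → Model equations S → Dialg S
  toDialg = ToDialg.dialg

  toDialg∘toModel : ∀ {S} (D : Dialg S) → SameDialg (toDialg (toModel D)) D
  toDialg∘toModel {S} D = record
    { same-≤ = λ _ _ → ≤⇔≼ _≈_ _∨_ _∧_ _⇨_ ⊤ ⊥ (IsHeytingAlgebra.isMeetSemilattice isHA)
    ; same-∧ = λ _ _ → refl ; same-∨ = λ _ _ → refl ; same-⇨ = λ _ _ → refl
    ; same-⊤ = refl ; same-⊥ = refl
    ; same-α = λ t → sym (FromDialg.α≈evalL D t)
    }
    where
      open Setoid S using (_≈_; refl; sym)
      open HAStr (Dialg.ha D) using (_∨_; _∧_; _⇨_; ⊤; ⊥) renaming (isHeytingAlgebra to isHA)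

  toModel∘toDialg : ∀ {S} (M : Model equations S) →
                    SameAlgebra (Model.algebra (toModel (toDialg M))) (Model.algebra M)
  toModel∘toDialg {S} M = record { same-op = same-op }
    where
      open Setoid S using (_≈_; refl)
      same-op : (o : Op) (as : Vec (Setoid.Carrier S) (arity o)) →
                FromDialg.ops (toDialg M) o as ≈ Model.⟦_⟧op M o as
      same-op ∨ᵒ (a ∷ b ∷ []) = refl
      same-op ∧ᵒ (a ∷ b ∷ []) = refl
      same-op ⇨ᵒ (a ∷ b ∷ []) = refl
      same-op ⊤ᵒ []           = refl
      same-op ⊥ᵒ []           = refl
      same-op (♡ᵒ i) as       = refl

  isDialgHom⇔isAlgHom : ∀ {S S′} (D : Dialg S) (D′ : Dialg S′) h →
                        IsDialgHom D D′ h ⇔ IsAlgHom (FromDialg.algebra D) (FromDialg.algebra D′) h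
  isDialgHom⇔isAlgHom {S} {S′} D D′ h = mk⇔ toAlgHom toDialgHom
    where
      open Setoid S′ using (_≈_; sym; trans)

      toAlgHom : IsDialgHom D D′ h → IsAlgHom (FromDialg.algebra D) (FromDialg.algebra D′) h
      toAlgHom hom = record { cong = cong ; pres = pres }
        where
          open IsDialgHom hom using (heyting; comm)
          open IsHeytingHom heyting
          pres : (o : Op) (as : Vec (Setoid.Carrier S) (arity o)) →
                 h (FromDialg.ops D o as) ≈ FromDialg.ops D′ o (Vec.map h as)
          pres ∨ᵒ (a ∷ b ∷ []) = pres-∨ a b
          pres ∧ᵒ (a ∷ b ∷ []) = pres-∧ a b
          pres ⇨ᵒ (a ∷ b ∷ []) = pres-⇨ a b
          pres ⊤ᵒ []           = pres-⊤
          pres ⊥ᵒ []           = pres-⊥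
          pres (♡ᵒ i) as       = comm (gen i as)

      toDialgHom : IsAlgHom (FromDialg.algebra D) (FromDialg.algebra D′) h → IsDialgHom D D′ h
      toDialgHom hom = record
        { heyting = record
          { cong   = cong
          ; pres-∧ = λ a b → pres ∧ᵒ (a ∷ b ∷ [])
          ; pres-∨ = λ a b → pres ∨ᵒ (a ∷ b ∷ [])
          ; pres-⇨ = λ a b → pres ⇨ᵒ (a ∷ b ∷ [])
          ; pres-⊤ = pres ⊤ᵒ []
          ; pres-⊥ = pres ⊥ᵒ []
          }
        ; comm = λ t → trans (cong (FromDialg.α≈evalL D t))
                             (trans (evalL-hom hom t) (sym (FromDialg.α≈evalL D′ (Lmap h t))))
        }
        where open IsAlgHom hom

  isAlgHom⇔isDialgHom : ∀ {S S′} (M : Model equations S) (M′ : Model equations S′) h →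
                        IsAlgHom (Model.algebra M) (Model.algebra M′) h ⇔ IsDialgHom (toDialg M) (toDialg M′) h
  isAlgHom⇔isDialgHom M M′ h = Equivalence-trans
    (mk⇔ (IsAlgHom-resp-SameAlgebra (SameAlgebra-sym (toModel∘toDialg M)) (SameAlgebra-sym (toModel∘toDialg M′)))
         (IsAlgHom-resp-SameAlgebra (toModel∘toDialg M) (toModel∘toDialg M′)))
    (Equivalence-sym (isDialgHom⇔isAlgHom (toDialg M) (toDialg M′) h))

  isVariety : IsVarietyWitness I ar J ax rk signature equations
  isVariety = record
    { F    = toModel
    ; G    = toDialg
    ; GF   = toDialg∘toModel
    ; FG   = toModel∘toDialg
    ; homF = isDialgHom⇔isAlgHom
    ; homG = isAlgHom⇔isDialgHom
    }

lemma3p19 : (T : Functor) (I : Set₁) (ar : I → ℕ)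
            (Λ : (i : I) → PredLifting T (ar i))
            (J : Set₁) (ax : J → Syntax.Form I ar × Syntax.Form I ar)
            (rk : (j : J) → Syntax.Rank1 I ar (proj₁ (ax j)) × Syntax.Rank1 I ar (proj₂ (ax j)))
            (sound : (j : J) → Semantics.Sound T I ar Λ (ax j)) →
            DialgIsVariety I ar J ax rk
lemma3p19 T I ar Λ J ax rk sound = signature , equations , isVariety
  where open Dialgebras I ar J ax rk
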